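{- Let $n\ge 1$. In the group algebra $\mathbb{Z}[B_n]$ define $\Psi_1 = 1+s_0$ and, for $2\le i\le n$, \[ \Psi_i = 1 + s_{i-1}\cdot\Psi_{i-1} + s_{i-1}s_{i-2}\cdots s_1 s_0 s_1\cdots s_{i-1}. \] Then $\Psi_1\Psi_2\cdots\Psi_n = \sum_{w\in B_n} w$.
   Context: $B_n$ is the hyperoctahedral group: bijections $w$ of $\{\pm1,\ldots,\pm n\}$ with $w(-i)=-w(i)$, written in one-line notation $w=w_1\cdots w_n$ with $w_i=w(i)$ (negative values written with bars). Products are composition, $(uv)(x)=u(v(x))$. $s_0$ is the signed permutation exchanging $1$ and $-1$ and fixing all other elements; for $1\le i\le n-1$, $s_i$ exchanges $i\leftrightarrow i+1$ and $-i\leftrightarrow -(i+1)$ and fixes the rest. Thus $w s_0$ negates the first entry of $w$ and $w s_i$ swaps the entries in positions $i,i+1$. -}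

module Defs where

open import Data.Bool using (Bool; true; false; not)
open import Data.Bool.Properties using (not-involutive) renaming (_≟_ to _≟Bool_)
open import Data.Nat using (ℕ; zero; suc; _<_; _<?_)
open import Data.Nat.Properties using (<-trans; n<1+n)
open import Data.Fin using (Fin; fromℕ<) renaming (zero to fz; suc to fs)
open import Data.Fin.Properties using (all?) renaming (_≟_ to _≟Fin_)
open import Data.Fin.Permutation.Components using (transpose; transpose-inverse)
open import Data.Integer using (ℤ; 0ℤ; 1ℤ) renaming (_+_ to _+ℤ_; _*_ to _*ℤ_)
open import Data.List using (List; []; _∷_; _++_; concatMap)
open import Data.Product using (_×_; _,_)
open import Relation.Binary.PropositionalEquality using (_≡_; refl; cong; trans)
open import Relation.Nullary using (Dec; yes; no; does)
open import Relation.Nullary.Decidable using (map′)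
open import Function using (_∘_; id)

-- The signed set {±1,…,±n}: (true , i) is +(i+1), (false , i) is -(i+1)
-- (Fin n = {0,…,n-1} encodes the absolute values 1,…,n).

Signed : ℕ → Set
Signed n = Bool × Fin n

neg : ∀ {n} → Signed n → Signed n
neg (b , i) = (not b , i)

record B (n : ℕ) : Set where
  field
    fun  : Signed n → Signed n
    inv  : Signed n → Signed n
    odd  : ∀ x → fun (neg x) ≡ neg (fun x)
    linv : ∀ x → inv (fun x) ≡ x
    rinv : ∀ x → fun (inv x) ≡ x
open B public

_≈B_ : ∀ {n} → B n → B n → Set
u ≈B v = ∀ x → fun u x ≡ fun v x

_≟Signed_ : ∀ {n} (x y : Signed n) → Dec (x ≡ y)
(b , i) ≟Signed (c , j) with b ≟Bool c | i ≟Fin j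
... | yes refl | yes refl = yes refl
... | no b≢c   | _        = no λ { refl → b≢c refl }
... | yes _    | no i≢j   = no λ { refl → i≢j refl }

_≟B_ : ∀ {n} (u v : B n) → Dec (u ≈B v)
u ≟B v with all? (λ i → fun u (true , i) ≟Signed fun v (true , i))
          | all? (λ i → fun u (false , i) ≟Signed fun v (false , i))
... | yes p | yes q = yes λ { (true , i) → p i ; (false , i) → q i }
... | no ¬p | _     = no λ h → ¬p (λ i → h (true , i))
... | yes _ | no ¬q = no λ h → ¬q (λ i → h (false , i))

e : ∀ {n} → B n
e = record { fun = id ; inv = id ; odd = λ _ → refl
           ; linv = λ _ → refl ; rinv = λ _ → refl }

_·_ : ∀ {n} → B n → B n → B n
u · v = record
  { fun  = fun u ∘ fun v
  ; inv  = inv v ∘ inv u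
  ; odd  = λ x → trans (cong (fun u) (odd v x)) (odd u (fun v x))
  ; linv = λ x → trans (cong (inv v) (linv u (fun v x))) (linv v x)
  ; rinv = λ x → trans (cong (fun u) (rinv v (inv u x))) (rinv u x)
  }

-- Generators.  s₀ exchanges 1 and -1; for 1 ≤ i ≤ n-1, s i exchanges
-- i ↔ i+1 and -i ↔ -(i+1).  (For i ≥ n, s i is the identity; such
-- indices are never used below.)

s0fun : ∀ {n} → Signed n → Signed n
s0fun (b , fz)   = (not b , fz)
s0fun (b , fs j) = (b , fs j)

s0inv : ∀ {n} (x : Signed n) → s0fun (s0fun x) ≡ x
s0inv (b , fz)   = cong (_, fz) (not-involutive b)
s0inv (b , fs j) = refl

s0odd : ∀ {n} (x : Signed n) → s0fun (neg x) ≡ neg (s0fun x)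
s0odd (b , fz)   = refl
s0odd (b , fs j) = refl

s₀ : ∀ {n} → B n
s₀ = record { fun = s0fun ; inv = s0fun ; odd = s0odd
            ; linv = s0inv ; rinv = s0inv }

swap : ∀ {n} → Fin n → Fin n → B n
swap a c = record
  { fun  = λ { (b , i) → (b , transpose a c i) }
  ; inv  = λ { (b , i) → (b , transpose c a i) }
  ; odd  = λ { (b , i) → refl }
  ; linv = λ { (b , i) → cong (b ,_) (transpose-inverse c a) }
  ; rinv = λ { (b , i) → cong (b ,_) (transpose-inverse a c) }
  }

s : ∀ {n} → ℕ → B n
s zero = s₀
s {n} (suc k) with suc k <? n
... | yes k+1<n = swap (fromℕ< (<-trans (n<1+n k) k+1<n)) (fromℕ< k+1<n)
... | no _ = e

-- The group algebra ℤ[B_n]: finite formal ℤ-linear combinations of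
-- elements of B_n, represented as lists of (coefficient , element);
-- two combinations are equal iff all their coefficients agree.

ℤB : ℕ → Set
ℤB n = List (ℤ × B n)

coeff : ∀ {n} → ℤB n → B n → ℤ
coeff []            w = 0ℤ
coeff ((a , u) ∷ c) w with does (u ≟B w)
... | true  = a +ℤ coeff c w
... | false = coeff c w

_≈ℤB_ : ∀ {n} → ℤB n → ℤB n → Set
x ≈ℤB y = ∀ w → coeff x w ≡ coeff y w

[_] : ∀ {n} → B n → ℤB n
[ u ] = (1ℤ , u) ∷ []

𝟙 : ∀ {n} → ℤB n
𝟙 = [ e ]

_⊕_ : ∀ {n} → ℤB n → ℤB n → ℤB n
_⊕_ = _++_

_⊗_ : ∀ {n} → ℤB n → ℤB n → ℤB n
x ⊗ y = concatMap (λ { (a , u) → concatMap (λ { (b , v) → (a *ℤ b , u · v) ∷ [] }) y }) x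

-- The elements Ψ_i.
-- t k = s_k s_{k-1} ⋯ s_1 s_0 s_1 ⋯ s_k
t : ∀ {n} → ℕ → B n
t zero    = s₀
t (suc k) = s (suc k) · (t k · s (suc k))

-- Ψ 1 = 1 + s₀ ;  Ψ i = 1 + s_{i-1} Ψ_{i-1} + s_{i-1}⋯s_1 s_0 s_1⋯s_{i-1}  (i ≥ 2).
-- (Ψ 0 is never used; it is set to 1.)
Ψ : ∀ {n} → ℕ → ℤB n
Ψ zero          = 𝟙
Ψ (suc zero)    = 𝟙 ⊕ [ s₀ ]
Ψ (suc (suc k)) = (𝟙 ⊕ ([ s (suc k) ] ⊗ Ψ (suc k))) ⊕ [ t (suc k) ]

ΨProd : ∀ {n} → ℕ → ℤB n
ΨProd zero    = 𝟙
ΨProd (suc k) = ΨProd k ⊗ Ψ (suc k)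

IsSumOfAll : ∀ {n} → ℤB n → Set
IsSumOfAll {n} x = (w : B n) → coeff x w ≡ 1ℤ

-- Write B_k ⊆ B_n for the signed permutations fixing every entry of
-- absolute value > k.  By induction on k, Ψ_1 ⋯ Ψ_k is the sum of the
-- elements of B_k.  All terms v of Ψ_{k+1} lie in B_{k+1}, and the
-- values v⁻¹(k+1) run through ±1, …, ±(k+1), each exactly once.  Since
-- for v, w ∈ B_{k+1} we have w v⁻¹ ∈ B_k iff v⁻¹(k+1) = w⁻¹(k+1), the
-- terms of Ψ_{k+1} are a system of representatives of the right cosets
-- of B_k in B_{k+1}, so (Σ B_k) Ψ_{k+1} = Σ B_{k+1}.
module Submission where

open import Defs
open import Algebra.Properties.CommutativeSemigroup using (interchange; x∙yz≈y∙xz)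
open import Data.Bool using (Bool; true; false; not; if_then_else_)
open import Data.Empty using (⊥-elim)
open import Data.Fin using (Fin; fromℕ<; toℕ) renaming (zero to fz; suc to fs)
open import Data.Fin.Properties using (all?; toℕ-fromℕ<; toℕ-injective; toℕ<n) renaming (_≟_ to _≟Fin_)
open import Data.Fin.Permutation.Components using (transpose)
open import Data.Integer using (ℤ; 0ℤ; 1ℤ) renaming (_+_ to _+ℤ_; _*_ to _*ℤ_)
open import Data.Integer.Properties
  using (+-identityˡ; +-identityʳ; *-identityˡ; *-zeroʳ; +-assoc; *-assoc; *-comm; *-distribˡ-+;
         +-commutativeSemigroup; *-commutativeSemigroup)
open import Data.List using ([]; _∷_; _++_; concatMap)
open import Data.List.Relation.Unary.All as All using (All; []; _∷_)
open import Data.List.Relation.Unary.All.Properties using (++⁺; concat⁺; map⁺)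
open import Data.Nat using (ℕ; zero; suc; _≤_; _<_; _≥_; _≤?_; _<?_; z≤n)
open import Data.Nat.Properties
  using (<-trans; n<1+n; ≤-refl; ≤-reflexive; ≤-trans; n≤1+n; <-irrefl; ≰⇒>; <⇒≱; ≤∧≢⇒<; m≤n⇒m≤1+n; ≤-pred)
open import Data.Product using (_×_; _,_; proj₂)
open import Function using (_∘_; _⇔_; mk⇔)
open import Relation.Binary.PropositionalEquality
  using (_≡_; _≢_; _≗_; refl; sym; trans; cong; cong₂; subst; module ≡-Reasoning)
open import Relation.Nullary using (Dec; yes; no; does; ¬_)
open import Relation.Nullary.Decidable using (map′; _→-dec_; does-⇔; dec-true; dec-false)

open ≡-Reasoning

private
  variable
    k m n : ℕ

𝕀 : ∀ {A : Set} → Dec A → ℤ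
𝕀 a? = if does a? then 1ℤ else 0ℤ

𝕀-yes : ∀ {A : Set} → A → (a? : Dec A) → 𝕀 a? ≡ 1ℤ
𝕀-yes a a? = cong (if_then 1ℤ else 0ℤ) (dec-true a? a)

𝕀-no : ∀ {A : Set} → ¬ A → (a? : Dec A) → 𝕀 a? ≡ 0ℤ
𝕀-no ¬a a? = cong (if_then 1ℤ else 0ℤ) (dec-false a? ¬a)

𝕀-⇔ : ∀ {A B : Set} → A ⇔ B → (a? : Dec A) (b? : Dec B) → 𝕀 a? ≡ 𝕀 b?
𝕀-⇔ A⇔B a? b? = cong (if_then 1ℤ else 0ℤ) (does-⇔ A⇔B a? b?)

∑ : ℤB n → (B n → ℤ) → ℤ
∑ []            f = 0ℤ
∑ ((a , u) ∷ x) f = a *ℤ f u +ℤ ∑ x f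

∑-singleton : (u : B n) (f : B n → ℤ) → ∑ [ u ] f ≡ f u
∑-singleton u f = trans (+-identityʳ _) (*-identityˡ _)

∑-++ : (x y : ℤB n) (f : B n → ℤ) → ∑ (x ++ y) f ≡ ∑ x f +ℤ ∑ y f
∑-++ []            y f = sym (+-identityˡ _)
∑-++ ((a , u) ∷ x) y f = trans (cong (a *ℤ f u +ℤ_) (∑-++ x y f)) (sym (+-assoc (a *ℤ f u) (∑ x f) (∑ y f)))

∑-cong-All : ∀ {Q : B n → Set} (x : ℤB n) {f g : B n → ℤ} →
             All (Q ∘ proj₂) x → (∀ v → Q v → f v ≡ g v) → ∑ x f ≡ ∑ x g
∑-cong-All []            []         f≡g = refl
∑-cong-All ((a , u) ∷ x) (Qu ∷ Qx) f≡g = cong₂ _+ℤ_ (cong (a *ℤ_) (f≡g u Qu)) (∑-cong-All x Qx f≡g)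

∑-cong : (x : ℤB n) {f g : B n → ℤ} → f ≗ g → ∑ x f ≡ ∑ x g
∑-cong []            f≗g = refl
∑-cong ((a , u) ∷ x) f≗g = cong₂ _+ℤ_ (cong (a *ℤ_) (f≗g u)) (∑-cong x f≗g)

∑-zero : (x : ℤB n) → ∑ x (λ _ → 0ℤ) ≡ 0ℤ
∑-zero []            = refl
∑-zero ((a , u) ∷ x) = cong₂ _+ℤ_ (*-zeroʳ a) (∑-zero x)

*-∑ : (c : ℤ) (x : ℤB n) (f : B n → ℤ) → c *ℤ ∑ x f ≡ ∑ x (λ u → c *ℤ f u)
*-∑ c []            f = *-zeroʳ c
*-∑ c ((a , u) ∷ x) f = begin
  c *ℤ (a *ℤ f u +ℤ ∑ x f)
    ≡⟨ *-distribˡ-+ c _ _ ⟩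
  c *ℤ (a *ℤ f u) +ℤ c *ℤ ∑ x f
    ≡⟨ cong₂ _+ℤ_ (x∙yz≈y∙xz *-commutativeSemigroup c a (f u)) (*-∑ c x f) ⟩
  a *ℤ (c *ℤ f u) +ℤ ∑ x (λ u → c *ℤ f u) ∎

∑-+ : (x : ℤB n) (f g : B n → ℤ) → ∑ x f +ℤ ∑ x g ≡ ∑ x (λ u → f u +ℤ g u)
∑-+ []            f g = refl
∑-+ ((a , u) ∷ x) f g = begin
  (a *ℤ f u +ℤ ∑ x f) +ℤ (a *ℤ g u +ℤ ∑ x g)
    ≡⟨ interchange +-commutativeSemigroup (a *ℤ f u) (∑ x f) (a *ℤ g u) (∑ x g) ⟩
  (a *ℤ f u +ℤ a *ℤ g u) +ℤ (∑ x f +ℤ ∑ x g)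
    ≡⟨ cong₂ _+ℤ_ (sym (*-distribˡ-+ a (f u) (g u))) (∑-+ x f g) ⟩
  a *ℤ (f u +ℤ g u) +ℤ ∑ x (λ u → f u +ℤ g u) ∎

∑-comm : (x y : ℤB n) (h : B n → B n → ℤ) →
         ∑ x (λ u → ∑ y (h u)) ≡ ∑ y (λ v → ∑ x (λ u → h u v))
∑-comm []            y h = sym (∑-zero y)
∑-comm ((a , u) ∷ x) y h = begin
  a *ℤ ∑ y (h u) +ℤ ∑ x (λ u → ∑ y (h u))
    ≡⟨ cong₂ _+ℤ_ (*-∑ a y (h u)) (∑-comm x y h) ⟩
  ∑ y (λ v → a *ℤ h u v) +ℤ ∑ y (λ v → ∑ x (λ u → h u v))
    ≡⟨ ∑-+ y _ _ ⟩
  ∑ y (λ v → a *ℤ h u v +ℤ ∑ x (λ u → h u v)) ∎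

∑-concatMap : (F : ℤ × B n → ℤB n) (f g : B n → ℤ) →
              (∀ a u → ∑ (F (a , u)) f ≡ a *ℤ g u) →
              (x : ℤB n) → ∑ (concatMap F x) f ≡ ∑ x g
∑-concatMap F f g ∑F []            = refl
∑-concatMap F f g ∑F ((a , u) ∷ x) = begin
  ∑ (F (a , u) ++ concatMap F x) f       ≡⟨ ∑-++ (F (a , u)) (concatMap F x) f ⟩
  ∑ (F (a , u)) f +ℤ ∑ (concatMap F x) f ≡⟨ cong₂ _+ℤ_ (∑F a u) (∑-concatMap F f g ∑F x) ⟩
  a *ℤ g u +ℤ ∑ x g                      ∎

∑-⊗ : (x y : ℤB n) (f : B n → ℤ) → ∑ (x ⊗ y) f ≡ ∑ x (λ u → ∑ y (λ v → f (u · v)))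
∑-⊗ x y f = ∑-concatMap _ f _ (λ a u → ∑-row a u) x
  where
  ∑-row : ∀ a u → ∑ (concatMap (λ { (b , v) → (a *ℤ b , u · v) ∷ [] }) y) f ≡ a *ℤ ∑ y (λ v → f (u · v))
  ∑-row a u = trans (∑-concatMap _ f (λ v → a *ℤ f (u · v))
                       (λ b v → trans (+-identityʳ _) (trans (cong (_*ℤ f (u · v)) (*-comm a b)) (*-assoc b a _))) y)
                    (sym (*-∑ a y _))

coeff-∑ : (x : ℤB n) (w : B n) → coeff x w ≡ ∑ x (λ u → 𝕀 (u ≟B w))
coeff-∑ []            w = refl
coeff-∑ ((a , u) ∷ x) w with u ≟B w
... | yes _ = cong₂ _+ℤ_ (sym (trans (*-comm a 1ℤ) (*-identityˡ a))) (coeff-∑ x w)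
... | no _  = trans (coeff-∑ x w) (sym (trans (cong (_+ℤ _) (*-zeroʳ a)) (+-identityˡ _)))

infix 30 _⁻¹

_⁻¹ : B n → B n
v ⁻¹ = record { fun = inv v ; inv = fun v ; odd = inv-odd ; linv = rinv v ; rinv = linv v }
  where
  inv-odd : ∀ x → inv v (neg x) ≡ neg (inv v x)
  inv-odd x = begin
    inv v (neg x)                    ≡⟨ cong (inv v ∘ neg) (rinv v x) ⟨
    inv v (neg (fun v (inv v x)))    ≡⟨ cong (inv v) (odd v (inv v x)) ⟨
    inv v (fun v (neg (inv v x)))    ≡⟨ linv v _ ⟩
    neg (inv v x)                    ∎

·≈⇔≈·⁻¹ : (u v w : B n) → (u · v) ≈B w ⇔ u ≈B (w · v ⁻¹)
·≈⇔≈·⁻¹ u v w = mk⇔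
  (λ uv≈w x → trans (cong (fun u) (sym (rinv v x))) (uv≈w (inv v x)))
  (λ u≈wv⁻¹ x → trans (u≈wv⁻¹ (fun v x)) (cong (fun w) (linv v x)))

coeff-⊗ : (x y : ℤB n) (w : B n) → coeff (x ⊗ y) w ≡ ∑ y (λ v → coeff x (w · v ⁻¹))
coeff-⊗ x y w = begin
  coeff (x ⊗ y) w                              ≡⟨ coeff-∑ (x ⊗ y) w ⟩
  ∑ (x ⊗ y) (λ g → 𝕀 (g ≟B w))                 ≡⟨ ∑-⊗ x y _ ⟩
  ∑ x (λ u → ∑ y (λ v → 𝕀 ((u · v) ≟B w)))     ≡⟨ ∑-comm x y _ ⟩
  ∑ y (λ v → ∑ x (λ u → 𝕀 ((u · v) ≟B w)))     ≡⟨ ∑-cong y (λ v → ∑-cong x (λ u → 𝕀-⇔ (·≈⇔≈·⁻¹ u v w)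
                                                     ((u · v) ≟B w) (u ≟B (w · v ⁻¹)))) ⟩
  ∑ y (λ v → ∑ x (λ u → 𝕀 (u ≟B (w · v ⁻¹))))  ≡⟨ ∑-cong y (λ v → coeff-∑ x _) ⟨
  ∑ y (λ v → coeff x (w · v ⁻¹))               ∎

transpose-matchˡ : (i j : Fin n) → transpose i j i ≡ j
transpose-matchˡ i j rewrite dec-true (i ≟Fin i) refl = refl

transpose-matchʳ : (i j : Fin n) → transpose i j j ≡ i
transpose-matchʳ i j with j ≟Fin i
... | yes j≡i = j≡i
... | no  _   rewrite dec-true (j ≟Fin j) refl = refl

transpose-fix : (i j l : Fin n) → l ≢ i → l ≢ j → transpose i j l ≡ l
transpose-fix i j l l≢i l≢j rewrite dec-false (l ≟Fin i) l≢i | dec-false (l ≟Fin j) l≢j = refl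

pred< : suc k < n → k < n
pred< = <-trans (n<1+n _)

≢-fromℕ< : (p : k < n) {j : Fin n} → k < toℕ j → j ≢ fromℕ< p
≢-fromℕ< p k<j refl = <-irrefl (sym (toℕ-fromℕ< p)) k<j

module _ (p : suc k < n) where

  s-fun : ∀ b i → fun (s {n} (suc k)) (b , i) ≡ (b , transpose (fromℕ< (pred< p)) (fromℕ< p) i)
  s-fun b i with suc k <? n
  ... | yes _ = refl
  ... | no ¬p = ⊥-elim (¬p p)

  s-inv : ∀ b i → inv (s {n} (suc k)) (b , i) ≡ (b , transpose (fromℕ< p) (fromℕ< (pred< p)) i)
  s-inv b i with suc k <? n
  ... | yes _ = refl
  ... | no ¬p = ⊥-elim (¬p p)

  s⁻¹-down : ∀ b → inv (s {n} (suc k)) (b , fromℕ< p) ≡ (b , fromℕ< (pred< p))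
  s⁻¹-down b = trans (s-inv b _) (cong (b ,_) (transpose-matchˡ (fromℕ< p) (fromℕ< (pred< p))))

  s⁻¹-up : ∀ b → inv (s {n} (suc k)) (b , fromℕ< (pred< p)) ≡ (b , fromℕ< p)
  s⁻¹-up b = trans (s-inv b _) (cong (b ,_) (transpose-matchʳ (fromℕ< p) (fromℕ< (pred< p))))

t⁻¹-negates : (p : k < n) (b : Bool) → inv (t {n} k) (b , fromℕ< p) ≡ (not b , fromℕ< p)
t⁻¹-negates {zero}  {suc n} p b = refl
t⁻¹-negates {suc k}         p b = begin
  inv (s (suc k)) (inv (t k) (inv (s (suc k)) (b , fromℕ< p)))
    ≡⟨ cong (inv (s (suc k)) ∘ inv (t k)) (s⁻¹-down p b) ⟩
  inv (s (suc k)) (inv (t k) (b , fromℕ< (pred< p)))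
    ≡⟨ cong (inv (s (suc k))) (t⁻¹-negates (pred< p) b) ⟩
  inv (s (suc k)) (not b , fromℕ< (pred< p))
    ≡⟨ s⁻¹-up p (not b) ⟩
  (not b , fromℕ< p) ∎

-- The parabolic subgroups B_m ⊆ B_n

-- Position j carries the entry j+1, so InB m g says that g fixes every
-- entry of absolute value > m.
record InB {n : ℕ} (m : ℕ) (g : B n) : Set where
  constructor fixing
  field fixes : ∀ j → m ≤ toℕ j → fun g (true , j) ≡ (true , j)
open InB

InB? : (m : ℕ) (g : B n) → Dec (InB m g)
InB? m g = map′ fixing fixes (all? (λ j → (m ≤? toℕ j) →-dec (fun g (true , j) ≟Signed (true , j))))

InB-fixes : {g : B n} → InB m g → ∀ {b j} → m ≤ toℕ j → fun g (b , j) ≡ (b , j)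
InB-fixes g∈ {true}  m≤j = fixes g∈ _ m≤j
InB-fixes {g = g} g∈ {false} {j} m≤j = trans (odd g (true , j)) (cong neg (fixes g∈ j m≤j))

InB-full : (g : B n) → InB n g
InB-full g = fixing λ j n≤j → ⊥-elim (<⇒≱ (toℕ<n j) n≤j)

e≈⇔InB-zero : (g : B n) → e ≈B g ⇔ InB 0 g
e≈⇔InB-zero g = mk⇔ (λ e≈g → fixing λ j _ → sym (e≈g (true , j))) (λ g∈ x → sym (InB-fixes g∈ z≤n))

InB-suc : {g : B n} → InB m g → InB (suc m) g
InB-suc g∈ = fixing λ j m<j → fixes g∈ j (≤-trans (n≤1+n _) m<j)

InB-e : InB {n} m e
InB-e = fixing λ _ _ → refl

InB-· : {u v : B n} → InB m u → InB m v → InB m (u · v)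
InB-· {u = u} u∈ v∈ = fixing λ j m≤j → trans (cong (fun u) (fixes v∈ j m≤j)) (fixes u∈ j m≤j)

InB-⁻¹ : {g : B n} → InB m g → InB m (g ⁻¹)
InB-⁻¹ {g = g} g∈ = fixing λ j m≤j → trans (cong (inv g) (sym (fixes g∈ j m≤j))) (linv g _)

InB-·⁻¹-cancel : {v w : B n} → InB m v → InB m (w · v ⁻¹) → InB m w
InB-·⁻¹-cancel {w = w} v∈ wv⁻¹∈ = fixing λ j m≤j →
  trans (cong (fun w) (sym (fixes (InB-⁻¹ v∈) j m≤j))) (fixes wv⁻¹∈ j m≤j)

InB-s₀ : InB {n} 1 s₀
InB-s₀ = fixing λ { (fs j) _ → refl }

InB-s : (p : suc k < n) → InB (suc (suc k)) (s {n} (suc k))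
InB-s p = fixing λ j k+2≤j → trans (s-fun p true j) (cong (true ,_) (transpose-fix _ _ j
  (≢-fromℕ< (pred< p) (≤-trans (n≤1+n _) k+2≤j))
  (≢-fromℕ< p k+2≤j)))

InB-t : k < n → InB (suc k) (t {n} k)
InB-t {zero}  _ = InB-s₀
InB-t {suc k} p = InB-· (InB-s p) (InB-· (InB-suc (InB-t (pred< p))) (InB-s p))

InB-preimage-≤ : (p : k < n) {w : B n} → InB (suc k) w →
                 ∀ {x} → fun w x ≡ (true , fromℕ< p) → toℕ (proj₂ x) ≤ k
InB-preimage-≤ {k} p w∈ {b , j} wx≡ with toℕ j ≤? k
... | yes j≤k = j≤k
... | no  j≰k = ⊥-elim (≢-fromℕ< p (≰⇒> j≰k) (cong proj₂ (trans (sym (InB-fixes w∈ (≰⇒> j≰k))) wx≡)))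

InB-·⁻¹⇔ : (p : k < n) {v w : B n} → InB (suc k) v → InB (suc k) w →
           InB k (w · v ⁻¹) ⇔ inv v (true , fromℕ< p) ≡ inv w (true , fromℕ< p)
InB-·⁻¹⇔ {k} {n} p {v} {w} v∈ w∈ = mk⇔ to from
  where
  K : Fin n
  K = fromℕ< p
  to : InB k (w · v ⁻¹) → inv v (true , K) ≡ inv w (true , K)
  to wv⁻¹∈ = trans (sym (linv w _)) (cong (inv w) (fixes wv⁻¹∈ K (≤-reflexive (sym (toℕ-fromℕ< p)))))
  from : inv v (true , K) ≡ inv w (true , K) → InB k (w · v ⁻¹)
  from v⁻¹K≡w⁻¹K = fixing fixes-≥k
    where
    fixes-≥k : ∀ j → k ≤ toℕ j → fun (w · v ⁻¹) (true , j) ≡ (true , j)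
    fixes-≥k j k≤j with j ≟Fin K
    ... | yes refl = trans (cong (fun w) v⁻¹K≡w⁻¹K) (rinv w _)
    ... | no  j≢K  = trans (cong (fun w) (fixes (InB-⁻¹ v∈) j k<j)) (fixes w∈ j k<j)
      where
      k<j : k < toℕ j
      k<j = ≤∧≢⇒< k≤j (λ k≡j → j≢K (toℕ-injective (trans (sym k≡j) (sym (toℕ-fromℕ< p)))))

-- The terms of Ψ_{k+1} as coset representatives

InℤB : ℕ → ℤB n → Set
InℤB m x = All (InB m ∘ proj₂) x

InℤB-⊗ : {x y : ℤB n} → InℤB m x → InℤB m y → InℤB m (x ⊗ y)
InℤB-⊗ x∈ y∈ = concat⁺ (map⁺ (All.map (λ { {a , u} u∈ →
                  concat⁺ (map⁺ (All.map (λ { {b , v} v∈ → InB-· u∈ v∈ ∷ [] }) y∈)) }) x∈))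

InℤB-Ψ : k < n → InℤB (suc k) (Ψ {n} (suc k))
InℤB-Ψ {zero}  _ = InB-e ∷ InB-s₀ ∷ []
InℤB-Ψ {suc k} p = InB-e ∷ ++⁺ {xs = [ s (suc k) ] ⊗ Ψ (suc k)}
  (InℤB-⊗ {x = [ s (suc k) ]} (InB-s p ∷ []) (All.map InB-suc (InℤB-Ψ (pred< p))))
  (InB-t p ∷ [])

∑-Ψ-suc : (k : ℕ) (f : B n → ℤ) →
          ∑ (Ψ (suc (suc k))) f ≡ f e +ℤ (∑ (Ψ (suc k)) (λ v → f (s (suc k) · v)) +ℤ f (t (suc k)))
∑-Ψ-suc k f = cong₂ _+ℤ_ (*-identityˡ (f e)) (begin
  ∑ (([ s (suc k) ] ⊗ Ψ (suc k)) ++ [ t (suc k) ]) f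
    ≡⟨ ∑-++ ([ s (suc k) ] ⊗ Ψ (suc k)) _ f ⟩
  ∑ ([ s (suc k) ] ⊗ Ψ (suc k)) f +ℤ ∑ [ t (suc k) ] f
    ≡⟨ cong (_+ℤ ∑ [ t (suc k) ] f) (∑-⊗ [ s (suc k) ] (Ψ (suc k)) f) ⟩
  ∑ [ s (suc k) ] (λ u → ∑ (Ψ (suc k)) (λ v → f (u · v))) +ℤ ∑ [ t (suc k) ] f
    ≡⟨ cong₂ _+ℤ_ (∑-singleton (s (suc k)) (λ u → ∑ (Ψ (suc k)) (λ v → f (u · v))))
                  (∑-singleton (t (suc k)) f) ⟩
  ∑ (Ψ (suc k)) (λ v → f (s (suc k) · v)) +ℤ f (t (suc k)) ∎)

𝕀-≤-suc : (p : suc k < n) (q : Signed n) →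
          𝕀 ((true , fromℕ< p) ≟Signed q) +ℤ (𝕀 (toℕ (proj₂ q) ≤? k) +ℤ 𝕀 ((false , fromℕ< p) ≟Signed q))
            ≡ 𝕀 (toℕ (proj₂ q) ≤? suc k)
𝕀-≤-suc {k} {n} p (b , j) with j ≟Fin fromℕ< p
... | yes refl = trans (hit b) (sym (𝕀-yes (≤-reflexive K≡k+1) (toℕ K ≤? suc k)))
  where
  K : Fin n
  K = fromℕ< p
  K≡k+1 : toℕ K ≡ suc k
  K≡k+1 = toℕ-fromℕ< p
  K≰k : ¬ toℕ K ≤ k
  K≰k K≤k = <-irrefl refl (subst (_≤ k) K≡k+1 K≤k)
  hit : ∀ b → 𝕀 ((true , K) ≟Signed (b , K)) +ℤ (𝕀 (toℕ K ≤? k) +ℤ 𝕀 ((false , K) ≟Signed (b , K))) ≡ 1ℤ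
  hit true  = cong₂ _+ℤ_ (𝕀-yes refl ((true , K) ≟Signed (true , K)))
                         (cong₂ _+ℤ_ (𝕀-no K≰k (toℕ K ≤? k)) (𝕀-no (λ ()) ((false , K) ≟Signed (true , K))))
  hit false = cong₂ _+ℤ_ (𝕀-no (λ ()) ((true , K) ≟Signed (false , K)))
                         (cong₂ _+ℤ_ (𝕀-no K≰k (toℕ K ≤? k)) (𝕀-yes refl ((false , K) ≟Signed (false , K))))
... | no j≢K = begin
  𝕀 ((true , K) ≟Signed (b , j)) +ℤ (𝕀 (toℕ j ≤? k) +ℤ 𝕀 ((false , K) ≟Signed (b , j)))
    ≡⟨ cong₂ _+ℤ_ (𝕀-no (≢j ∘ cong proj₂) ((true , K) ≟Signed (b , j)))
                  (cong (𝕀 (toℕ j ≤? k) +ℤ_) (𝕀-no (≢j ∘ cong proj₂) ((false , K) ≟Signed (b , j)))) ⟩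
  0ℤ +ℤ (𝕀 (toℕ j ≤? k) +ℤ 0ℤ)
    ≡⟨ trans (+-identityˡ _) (+-identityʳ _) ⟩
  𝕀 (toℕ j ≤? k)
    ≡⟨ 𝕀-⇔ (mk⇔ m≤n⇒m≤1+n (λ j≤k+1 → ≤-pred (≤∧≢⇒< j≤k+1 j≢k+1))) (toℕ j ≤? k) (toℕ j ≤? suc k) ⟩
  𝕀 (toℕ j ≤? suc k) ∎
  where
  K : Fin n
  K = fromℕ< p
  ≢j : K ≢ j
  ≢j = j≢K ∘ sym
  j≢k+1 : toℕ j ≢ suc k
  j≢k+1 j≡k+1 = j≢K (toℕ-injective (trans j≡k+1 (sym (toℕ-fromℕ< p))))

Ψ-preimages : (p : k < n) (q : Signed n) →
              ∑ (Ψ (suc k)) (λ v → 𝕀 (inv v (true , fromℕ< p) ≟Signed q)) ≡ 𝕀 (toℕ (proj₂ q) ≤? k)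
Ψ-preimages {zero}  {suc n} p (true  , fz)   = refl
Ψ-preimages {zero}  {suc n} p (false , fz)   = refl
Ψ-preimages {zero}  {suc n} p (true  , fs j) = refl
Ψ-preimages {zero}  {suc n} p (false , fs j) = refl
Ψ-preimages {suc k} {n}     p q = begin
  ∑ (Ψ (suc (suc k))) (λ v → 𝕀 (inv v K ≟Signed q))
    ≡⟨ ∑-Ψ-suc k (λ v → 𝕀 (inv v K ≟Signed q)) ⟩
  𝕀 (K ≟Signed q) +ℤ (∑ (Ψ (suc k)) (λ v → 𝕀 (inv v (inv (s (suc k)) K) ≟Signed q))
                       +ℤ 𝕀 (inv (t (suc k)) K ≟Signed q))
    ≡⟨ cong (𝕀 (K ≟Signed q) +ℤ_)
            (cong₂ _+ℤ_ IH (cong (λ x → 𝕀 (x ≟Signed q)) (t⁻¹-negates p true))) ⟩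
  𝕀 (K ≟Signed q) +ℤ (𝕀 (toℕ (proj₂ q) ≤? k) +ℤ 𝕀 ((false , fromℕ< p) ≟Signed q))
    ≡⟨ 𝕀-≤-suc p q ⟩
  𝕀 (toℕ (proj₂ q) ≤? suc k) ∎
  where
  K : Signed n
  K = (true , fromℕ< p)
  IH : ∑ (Ψ (suc k)) (λ v → 𝕀 (inv v (inv (s (suc k)) K) ≟Signed q)) ≡ 𝕀 (toℕ (proj₂ q) ≤? k)
  IH = trans (∑-cong (Ψ (suc k)) (λ v → cong (λ x → 𝕀 (inv v x ≟Signed q)) (s⁻¹-down p true)))
             (Ψ-preimages (pred< p) q)

∑-Ψ-InB : (p : k < n) (w : B n) →
          ∑ (Ψ (suc k)) (λ v → 𝕀 (InB? k (w · v ⁻¹))) ≡ 𝕀 (InB? (suc k) w)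
∑-Ψ-InB {k} {n} p w = by-cases (InB? (suc k) w)
  where
  K : Signed n
  K = (true , fromℕ< p)
  by-cases : (w∈? : Dec (InB (suc k) w)) → ∑ (Ψ (suc k)) (λ v → 𝕀 (InB? k (w · v ⁻¹))) ≡ 𝕀 w∈?
  by-cases (yes w∈) = begin
    ∑ (Ψ (suc k)) (λ v → 𝕀 (InB? k (w · v ⁻¹)))
      ≡⟨ ∑-cong-All (Ψ (suc k)) (InℤB-Ψ p) (λ v v∈ →
           𝕀-⇔ (InB-·⁻¹⇔ p v∈ w∈) (InB? k (w · v ⁻¹)) (inv v K ≟Signed inv w K)) ⟩
    ∑ (Ψ (suc k)) (λ v → 𝕀 (inv v K ≟Signed inv w K))
      ≡⟨ Ψ-preimages p (inv w K) ⟩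
    𝕀 (toℕ (proj₂ (inv w K)) ≤? k)
      ≡⟨ 𝕀-yes (InB-preimage-≤ p w∈ (rinv w K)) (toℕ (proj₂ (inv w K)) ≤? k) ⟩
    1ℤ ∎
  by-cases (no w∉) = begin
    ∑ (Ψ (suc k)) (λ v → 𝕀 (InB? k (w · v ⁻¹)))
      ≡⟨ ∑-cong-All (Ψ (suc k)) (InℤB-Ψ p) (λ v v∈ →
           𝕀-no (w∉ ∘ InB-·⁻¹-cancel v∈ ∘ InB-suc) (InB? k (w · v ⁻¹))) ⟩
    ∑ (Ψ (suc k)) (λ _ → 0ℤ)
      ≡⟨ ∑-zero (Ψ (suc k)) ⟩
    0ℤ ∎

coeff-ΨProd : k ≤ n → (w : B n) → coeff (ΨProd k) w ≡ 𝕀 (InB? k w)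
coeff-ΨProd {zero}  _   w = begin
  coeff 𝟙 w               ≡⟨ coeff-∑ 𝟙 w ⟩
  ∑ 𝟙 (λ u → 𝕀 (u ≟B w))  ≡⟨ ∑-singleton e (λ u → 𝕀 (u ≟B w)) ⟩
  𝕀 (e ≟B w)              ≡⟨ 𝕀-⇔ (e≈⇔InB-zero w) (e ≟B w) (InB? 0 w) ⟩
  𝕀 (InB? 0 w)            ∎
coeff-ΨProd {suc k} k<n w = begin
  coeff (ΨProd k ⊗ Ψ (suc k)) w                     ≡⟨ coeff-⊗ (ΨProd k) (Ψ (suc k)) w ⟩
  ∑ (Ψ (suc k)) (λ v → coeff (ΨProd k) (w · v ⁻¹)) ≡⟨ ∑-cong (Ψ (suc k)) (λ v →
                                                         coeff-ΨProd (≤-trans (n≤1+n k) k<n) (w · v ⁻¹)) ⟩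
  ∑ (Ψ (suc k)) (λ v → 𝕀 (InB? k (w · v ⁻¹)))      ≡⟨ ∑-Ψ-InB k<n w ⟩
  𝕀 (InB? (suc k) w)                                ∎

proposition3p1 : (n : ℕ) → n ≥ 1 → IsSumOfAll {n} (ΨProd {n} n)
proposition3p1 n _ w = trans (coeff-ΨProd ≤-refl w) (𝕀-yes (InB-full w) (InB? n w))
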